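{- Let $M$ be a $3\times3$ semi-magic square with upshifted representative $\mathbf a=(a_1,\dots,a_6)$, and let $m_0=\min(M)$. Then the number of lattice paths in $M(3)$ from the zero matrix to $M$ is $$v(M)=\sum_{t=0}^{m_0}\binom{\rho(M)}{a_1-t,\ a_2-t,\ a_3-t,\ a_4+t,\ a_5+t,\ a_6+t}.$$ Moreover, $v$ is constant on each orbit of the group $G$, i.e. $v(g\cdot M)=v(M)$ for all $g\in G$.
   Context: A semi-magic square of size 3 is a $3\times 3$ matrix with non-negative integer entries whose row sums and column sums all equal a common value $\rho(M)$ (the line sum); $M(3)$ is the set of all of them, and $\min(M)$ denotes the minimal entry of $M$. Fix the permutation matrices $P_1=I$, $P_2=\begin{bmatrix}0&0&1\\1&0&0\\0&1&0\end{bmatrix}$, $P_3=\begin{bmatrix}0&1&0\\0&0&1\\1&0&0\end{bmatrix}$, $P_4=\begin{bmatrix}0&0&1\\0&1&0\\1&0&0\end{bmatrix}$, $P_5=\begin{bmatrix}0&1&0\\1&0&0\\0&0&1\end{bmatrix}$, $P_6=\begin{bmatrix}1&0&0\\0&0&1\\0&1&0\end{bmatrix}$ (note $P_1+P_2+P_3=P_4+P_5+P_6$ is the all-ones matrix). A sextuple $\mathbf a$ of non-negative integers represents $M$ if $M=\sum_t a_tP_t$; every $M\in M(3)$ has such representatives, any two differing by an integer multiple of $(1,1,1,-1,-1,-1)$, and the upshifted representative is the unique one with $a_t=0$ for some $t\in\{4,5,6\}$. A lattice path in $M(3)$ from $0$ to $M$ is a sequence $0=M_0,M_1,\dots,M_{\rho(M)}=M$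 of matrices with each $M_i-M_{i-1}$ a $3\times3$ permutation matrix; $v(M)$ denotes the number of such paths. Multinomial coefficients are taken to be $0$ when some lower index is negative. $G$ is the group of transformations of $3\times 3$ matrices generated by row permutations, column permutations and transposition. -}

module Defs where

open import Data.Nat using (ℕ; zero; suc; _+_; _*_; _∸_; _⊓_)
open import Data.Nat.Combinatorics using (_C_)
open import Data.Integer as ℤ using (ℤ; +_; -[1+_])
open import Data.Fin using (Fin; zero; suc)
open import Data.Fin.Properties using (all?)
open import Data.Fin.Permutation using (Permutation′; _⟨$⟩ʳ_)
open import Data.Vec using (Vec; []; _∷_; lookup)
open import Data.List using (List; []; _∷_; length; filter; map; concatMap; foldr; upTo)
open import Data.Sum using (_⊎_)
open import Data.Product using (_×_)
open import Relation.Binary.PropositionalEquality using (_≡_)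
open import Relation.Nullary using (Dec)
import Data.Nat as ℕ
open import Data.Nat.ListAction using (sum)

Mat : Set
Mat = Fin 3 → Fin 3 → ℕ

mat : Vec (Vec ℕ 3) 3 → Mat
mat rows i j = lookup (lookup rows i) j

zeroM : Mat
zeroM _ _ = 0

_+M_ : Mat → Mat → Mat
(A +M B) i j = A i j + B i j

_·M_ : ℕ → Mat → Mat
(k ·M A) i j = k * A i j

_≋_ : Mat → Mat → Set
A ≋ B = ∀ i j → A i j ≡ B i j

_≋?_ : (A B : Mat) → Dec (A ≋ B)
A ≋? B = all? (λ i → all? (λ j → A i j ℕ.≟ B i j))

rowSum : Mat → Fin 3 → ℕ
rowSum A i = A i zero + A i (suc zero) + A i (suc (suc zero))

colSum : Mat → Fin 3 → ℕ
colSum A j = A zero j + A (suc zero) j + A (suc (suc zero)) j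

SemiMagic : Mat → Set
SemiMagic A = (∀ i → rowSum A i ≡ rowSum A zero) × (∀ j → colSum A j ≡ rowSum A zero)

ρ : Mat → ℕ
ρ A = rowSum A zero

minEntry : Mat → ℕ
minEntry A = (A zero zero ⊓ A zero (suc zero) ⊓ A zero (suc (suc zero)))
           ⊓ (A (suc zero) zero ⊓ A (suc zero) (suc zero) ⊓ A (suc zero) (suc (suc zero)))
           ⊓ (A (suc (suc zero)) zero ⊓ A (suc (suc zero)) (suc zero) ⊓ A (suc (suc zero)) (suc (suc zero)))

P₁ P₂ P₃ P₄ P₅ P₆ : Mat
P₁ = mat ((1 ∷ 0 ∷ 0 ∷ []) ∷ (0 ∷ 1 ∷ 0 ∷ []) ∷ (0 ∷ 0 ∷ 1 ∷ []) ∷ [])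
P₂ = mat ((0 ∷ 0 ∷ 1 ∷ []) ∷ (1 ∷ 0 ∷ 0 ∷ []) ∷ (0 ∷ 1 ∷ 0 ∷ []) ∷ [])
P₃ = mat ((0 ∷ 1 ∷ 0 ∷ []) ∷ (0 ∷ 0 ∷ 1 ∷ []) ∷ (1 ∷ 0 ∷ 0 ∷ []) ∷ [])
P₄ = mat ((0 ∷ 0 ∷ 1 ∷ []) ∷ (0 ∷ 1 ∷ 0 ∷ []) ∷ (1 ∷ 0 ∷ 0 ∷ []) ∷ [])
P₅ = mat ((0 ∷ 1 ∷ 0 ∷ []) ∷ (1 ∷ 0 ∷ 0 ∷ []) ∷ (0 ∷ 0 ∷ 1 ∷ []) ∷ [])
P₆ = mat ((1 ∷ 0 ∷ 0 ∷ []) ∷ (0 ∷ 0 ∷ 1 ∷ []) ∷ (0 ∷ 1 ∷ 0 ∷ []) ∷ [])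

permMatrices : List Mat
permMatrices = P₁ ∷ P₂ ∷ P₃ ∷ P₄ ∷ P₅ ∷ P₆ ∷ []

Represents : ℕ → ℕ → ℕ → ℕ → ℕ → ℕ → Mat → Set
Represents a₁ a₂ a₃ a₄ a₅ a₆ M =
  M ≋ ((a₁ ·M P₁) +M ((a₂ ·M P₂) +M ((a₃ ·M P₃) +M
       ((a₄ ·M P₄) +M ((a₅ ·M P₅) +M (a₆ ·M P₆))))))

Upshifted : ℕ → ℕ → ℕ → ℕ → ℕ → ℕ → Mat → Set
Upshifted a₁ a₂ a₃ a₄ a₅ a₆ M =
  Represents a₁ a₂ a₃ a₄ a₅ a₆ M × (a₄ ≡ 0 ⊎ a₅ ≡ 0 ⊎ a₆ ≡ 0)

words : ℕ → List (List Mat)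
words zero    = [] ∷ []
words (suc k) = concatMap (λ w → map (λ P → P ∷ w) permMatrices) (words k)

sumMats : List Mat → Mat
sumMats = foldr _+M_ zeroM

-- A lattice path 0 = M₀, M₁, …, M_ρ = M is determined by (and determines) the
-- sequence of its steps Mᵢ − Mᵢ₋₁, a word of length ρ(M) in the permutation
-- matrices with sum M.  v(M) counts these words.
v : Mat → ℕ
v M = length (filter (λ w → sumMats w ≋? M) (words (ρ M)))

-- on natural lower indices: binom(n; k₁,…,kᵣ) = C(n,k₁)·binom(n−k₁; k₂,…,kᵣ),
-- and binom(n; ) = 1 if n = 0, else 0   (so it is n!/∏kᵢ! when Σkᵢ = n, else 0)
multinomialℕ : ℕ → List ℕ → ℕ
multinomialℕ zero    []       = 1
multinomialℕ (suc n) []       = 0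
multinomialℕ n       (k ∷ ks) = (n C k) * multinomialℕ (n ∸ k) ks

multinomial : ℕ → List ℤ → ℕ
multinomial n ks = go ks []
  where
  go : List ℤ → List ℕ → ℕ
  go []             acc = multinomialℕ n (Data.List.reverse acc)
  go (+ k ∷ ks)     acc = go ks (k ∷ acc)
  go (-[1+ _ ] ∷ _) acc = 0

sumTo : ℕ → (ℕ → ℕ) → ℕ
sumTo m f = sum (map f (upTo (suc m)))

data GWord : Set where
  idG   : GWord
  rowP  : Permutation′ 3 → GWord → GWord
  colP  : Permutation′ 3 → GWord → GWord
  trans : GWord → GWord

act : GWord → Mat → Mat
act idG        M = M
act (rowP σ g) M = λ i j → act g M (σ ⟨$⟩ʳ i) j
act (colP σ g) M = λ i j → act g M i (σ ⟨$⟩ʳ j)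
act (trans g)  M = λ i j → act g M j i

-- A lattice path to M is a word of length ρ(M) in P₁, …, P₆ whose letters sum to M, and the
-- sum of a word is Σ cₜ Pₜ where c counts its letters; the words with count vector c are
-- counted by the multinomial coefficient of c. Every entry of Σ cₜ Pₜ is cᵢ + c₃₊ⱼ for one even
-- letter i and one odd letter j, and each of the nine pairs (i , j) occurs exactly once. Hence
-- Σ cₜ Pₜ = Σ aₜ Pₜ forces cᵢ + c₃₊ⱼ = aᵢ + a₃₊ⱼ, and as the upshifted a has some a₃₊ⱼ₀ = 0,
-- c = (a₁ − t, a₂ − t, a₃ − t, a₄ + t, a₅ + t, a₆ + t) with t = c₃₊ⱼ₀ ≤ min(M). Summing the
-- multinomial coefficients over t gives v(M); the terms with t > min(a₁, a₂, a₃) vanish.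
-- Each generator of G reindexes the nine positions and permutes P₁, …, P₆, so applying it
-- letter by letter is a bijection between the words reaching M and those reaching g · M.

module Submission where

module SemiMagicPaths where

  open import Defs hiding (trans)
  open import Data.Nat.Properties
  open import Data.Nat.Tactic.RingSolver using (solve-∀)
  open import Algebra.Properties.CommutativeSemigroup +-commutativeSemigroup using (x∙yz≈y∙xz; interchange)
  open import Algebra.Properties.CommutativeMonoid.Sum +-0-commutativeMonoid
    using (sum-syntax; ∑-comm; ∑-distrib-+; sum-cong-≗; sum-permute; sum-replicate-zero)
  open import Algebra.Properties.Semiring.Sum +-*-semiring using (*-distribˡ-sum)
  open import Data.Bool.Base using (true; false; if_then_else_)
  open import Data.Empty using (⊥-elim)
  open import Data.Integer as ℤ using (ℤ; -[1+_])
  import Data.Integer.Properties as ℤ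
  open import Data.Fin as Fin using (Fin; zero; suc)
  open import Data.Fin.Properties using (all?; any?)
  open import Data.Fin.Patterns using (0F; 1F; 2F; 3F; 4F; 5F)
  open import Data.Fin.Permutation using (Permutation′; _⟨$⟩ʳ_; _⟨$⟩ˡ_; inverseˡ; inverseʳ; permutation)
  open import Data.List as List using (List; []; _∷_; length; filter; upTo; concatMap; _∷ʳ_)
  import Data.List.Properties as List
  open import Data.Maybe as Maybe using (Maybe; just; nothing; maybe′)
  open import Data.Maybe.Properties using (just-injective)
  open import Data.Nat using (ℕ; zero; suc; _+_; _*_; _∸_; _≤_; _<_; s≤s; _≟_; _≤?_; _<?_)
  open import Data.Nat.Combinatorics using (_C_; nCk+nC[k+1]≡[n+1]C[k+1])
  open import Data.Nat.Combinatorics.Specification using (k>n⇒nCk≡0)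
  open import Data.Nat.ListAction using (sum)
  open import Data.Nat.ListAction.Properties using (sum-++)
  open import Data.Product using (∃; ∃₂; _×_; _,_; proj₁; proj₂; uncurry)
  open import Data.Sum using (_⊎_; inj₁; inj₂)
  open import Data.Vec as Vec using (Vec; []; _∷_; replicate; updateAt; toList; lookup)
  import Data.Vec.Properties as Vec
  open import Data.Vec.Relation.Unary.All as All using (All; []; _∷_)
  open import Data.Vec.Relation.Unary.All.Properties using (lookup⁺; lookup⁻)
  open import Function using (_∘_)
  open import Relation.Binary.PropositionalEquality
    using (_≡_; _≢_; refl; sym; trans; cong; cong₂; subst; module ≡-Reasoning)
  open import Relation.Nullary using (Dec; does; yes; no; ¬_; map′; _×-dec_; _→-dec_; ¬?)
  open import Relation.Nullary.Decidable using (toWitness)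
  open import Relation.Unary using (Pred; Decidable)

  𝟙 : ∀ {a} {A : Set a} → Dec A → ℕ
  𝟙 a? = if does a? then 1 else 0

  𝟙-yes : ∀ {a} {A : Set a} (a? : Dec A) → A → 𝟙 a? ≡ 1
  𝟙-yes (yes _) _ = refl
  𝟙-yes (no ¬a) a = ⊥-elim (¬a a)

  𝟙-no : ∀ {a} {A : Set a} (a? : Dec A) → ¬ A → 𝟙 a? ≡ 0
  𝟙-no (yes a) ¬a = ⊥-elim (¬a a)
  𝟙-no (no _)  _  = refl

  𝟙-⇔ : ∀ {a b} {A : Set a} {B : Set b} (a? : Dec A) (b? : Dec B) → (A → B) → (B → A) → 𝟙 a? ≡ 𝟙 b?
  𝟙-⇔ a? (yes b) _  from = 𝟙-yes a? (from b)
  𝟙-⇔ a? (no ¬b) to _    = 𝟙-no a? (¬b ∘ to)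

  length-filter : ∀ {a p} {A : Set a} {P : Pred A p} (P? : Decidable P) xs →
                  length (filter P? xs) ≡ sum (List.map (𝟙 ∘ P?) xs)
  length-filter P? []       = refl
  length-filter P? (x ∷ xs) with does (P? x)
  ... | true  = cong suc (length-filter P? xs)
  ... | false = length-filter P? xs

  sum-upTo-suc : ∀ L (f : ℕ → ℕ) → sum (List.map f (upTo (suc L))) ≡ sum (List.map f (upTo L)) + f L
  sum-upTo-suc L f = begin
    sum (List.map f (upTo (suc L)))          ≡⟨ cong (sum ∘ List.map f) (sym (List.upTo-∷ʳ L)) ⟩
    sum (List.map f (upTo L ∷ʳ L))           ≡⟨ cong sum (List.map-++ f (upTo L) (L ∷ [])) ⟩
    sum (List.map f (upTo L) List.++ f L ∷ []) ≡⟨ sum-++ (List.map f (upTo L)) (f L ∷ []) ⟩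
    sum (List.map f (upTo L)) + (f L + 0)    ≡⟨ cong (sum (List.map f (upTo L)) +_) (+-identityʳ (f L)) ⟩
    sum (List.map f (upTo L)) + f L          ∎
    where open ≡-Reasoning

  sum-upTo-≡0 : ∀ L (f : ℕ → ℕ) → (∀ t → t < L → f t ≡ 0) → sum (List.map f (upTo L)) ≡ 0
  sum-upTo-≡0 zero    f f≡0 = refl
  sum-upTo-≡0 (suc L) f f≡0 = trans (sum-upTo-suc L f)
    (cong₂ _+_ (sum-upTo-≡0 L f (λ t t<L → f≡0 t (m<n⇒m<1+n t<L))) (f≡0 L ≤-refl))

  sum-upTo-single : ∀ {L t₀} (f : ℕ → ℕ) → t₀ < L → (∀ t → t ≢ t₀ → f t ≡ 0) →
                    sum (List.map f (upTo L)) ≡ f t₀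
  sum-upTo-single {suc L} {t₀} f t₀<1+L f≡0 with t₀ ≟ L
  ... | yes refl = trans (sum-upTo-suc L f)
    (cong (_+ f t₀) (sum-upTo-≡0 L f (λ t t<L → f≡0 t (<⇒≢ t<L))))
  ... | no t₀≢L  = trans (sum-upTo-suc L f) (trans
    (cong₂ _+_ (sum-upTo-single f (≤∧≢⇒< (≤-pred t₀<1+L) t₀≢L) f≡0) (f≡0 L (t₀≢L ∘ sym)))
    (+-identityʳ (f t₀)))

  sumTo-𝟙-unique : ∀ {p} {P : Pred ℕ p} m (P? : Decidable P) → (∀ {s t} → P s → P t → s ≡ t) →
                   (∀ {t} → P t → t ≤ m) → (∃P? : Dec (∃ P)) → sumTo m (𝟙 ∘ P?) ≡ 𝟙 ∃P?
  sumTo-𝟙-unique m P? unique bound (yes (t₀ , p₀)) =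
    trans (sum-upTo-single (𝟙 ∘ P?) (s≤s (bound p₀)) (λ t t≢t₀ → 𝟙-no (P? t) (λ p → t≢t₀ (unique p p₀))))
          (𝟙-yes (P? t₀) p₀)
  sumTo-𝟙-unique m P? unique bound (no ∄P) =
    sum-upTo-≡0 (suc m) (𝟙 ∘ P?) (λ t _ → 𝟙-no (P? t) (∄P ∘ (t ,_)))

  Word : ℕ → ℕ → Set
  Word r n = Vec (Fin r) n

  ∑ʷ : ∀ {r} n → (Word r n → ℕ) → ℕ
  ∑ʷ         zero    h = h []
  ∑ʷ {r = r} (suc n) h = ∑ʷ n (λ u → ∑[ i < r ] h (i ∷ u))

  ∑ʷ-cong : ∀ {r} n {h h′ : Word r n → ℕ} → (∀ u → h u ≡ h′ u) → ∑ʷ n h ≡ ∑ʷ n h′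
  ∑ʷ-cong zero    h≗h′ = h≗h′ []
  ∑ʷ-cong (suc n) h≗h′ = ∑ʷ-cong n (λ u → sum-cong-≗ (λ i → h≗h′ (i ∷ u)))

  ∑ʷ-zero : ∀ {r} n → ∑ʷ {r} n (λ _ → 0) ≡ 0
  ∑ʷ-zero         zero    = refl
  ∑ʷ-zero {r = r} (suc n) = trans (∑ʷ-cong n (λ _ → sum-replicate-zero r)) (∑ʷ-zero n)

  ∑ʷ-distrib-+ : ∀ {r} n (f g : Word r n → ℕ) → ∑ʷ n (λ u → f u + g u) ≡ ∑ʷ n f + ∑ʷ n g
  ∑ʷ-distrib-+ zero    f g = refl
  ∑ʷ-distrib-+ (suc n) f g = trans
    (∑ʷ-cong n (λ u → ∑-distrib-+ (λ i → f (i ∷ u)) (λ i → g (i ∷ u))))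
    (∑ʷ-distrib-+ n _ _)

  ∑ʷ-∑-comm : ∀ {r m} n (f : Word r n → Fin m → ℕ) →
              ∑ʷ n (λ u → ∑[ i < m ] f u i) ≡ ∑[ i < m ] ∑ʷ n (λ u → f u i)
  ∑ʷ-∑-comm zero    f = refl
  ∑ʷ-∑-comm (suc n) f = trans
    (∑ʷ-cong n (λ u → ∑-comm (λ j i → f (j ∷ u) i)))
    (∑ʷ-∑-comm n (λ u i → ∑[ j < _ ] f (j ∷ u) i))

  ∑ʷ-sum-comm : ∀ {r} {A : Set} n (f : Word r n → A → ℕ) xs →
                ∑ʷ n (λ u → sum (List.map (f u) xs)) ≡ sum (List.map (λ x → ∑ʷ n (λ u → f u x)) xs)
  ∑ʷ-sum-comm n f []       = ∑ʷ-zero n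
  ∑ʷ-sum-comm n f (x ∷ xs) =
    trans (∑ʷ-distrib-+ n (λ u → f u x) _) (cong (∑ʷ n (λ u → f u x) +_) (∑ʷ-sum-comm n f xs))

  ∑ʷ-permute : ∀ {r} n (π : Permutation′ r) (h : Word r n → ℕ) → ∑ʷ n h ≡ ∑ʷ n (h ∘ Vec.map (π ⟨$⟩ʳ_))
  ∑ʷ-permute zero    π h = refl
  ∑ʷ-permute (suc n) π h = trans
    (∑ʷ-cong n (λ u → sum-permute (λ i → h (i ∷ u)) π))
    (∑ʷ-permute n π (λ u → ∑[ i < _ ] h ((π ⟨$⟩ʳ i) ∷ u)))

  _≟ᵛ_ : ∀ {r} (k k′ : Vec ℕ r) → Dec (k ≡ k′)
  _≟ᵛ_ = Vec.≡-dec _≟_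

  tally : ∀ {r n} → Word r n → Vec ℕ r
  tally []      = replicate _ 0
  tally (i ∷ u) = updateAt (tally u) i suc

  predAt : ∀ {r} → Fin r → Vec ℕ r → Maybe (Vec ℕ r)
  predAt zero    (zero  ∷ k) = nothing
  predAt zero    (suc x ∷ k) = just (x ∷ k)
  predAt (suc i) (x ∷ k)     = Maybe.map (x ∷_) (predAt i k)

  predAt-updateAt : ∀ {r} (i : Fin r) c → predAt i (updateAt c i suc) ≡ just c
  predAt-updateAt zero    (x ∷ c) = refl
  predAt-updateAt (suc i) (x ∷ c) = cong (Maybe.map (x ∷_)) (predAt-updateAt i c)

  updateAt-predAt : ∀ {r} (i : Fin r) k {c} → predAt i k ≡ just c → updateAt c i suc ≡ k
  updateAt-predAt zero    (suc x ∷ k) refl = refl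
  updateAt-predAt (suc i) (x ∷ k)     eq   with predAt i k in eqᵢ
  updateAt-predAt (suc i) (x ∷ k)     refl | just c = cong (x ∷_) (updateAt-predAt i k eqᵢ)

  maybe′-map : ∀ {A B : Set} (f : B → ℕ) (g : A → B) m → maybe′ f 0 (Maybe.map g m) ≡ maybe′ (f ∘ g) 0 m
  maybe′-map f g (just x) = refl
  maybe′-map f g nothing  = refl

  maybe′-cong : ∀ {A : Set} {f g : A → ℕ} → (∀ x → f x ≡ g x) → ∀ m → maybe′ f 0 m ≡ maybe′ g 0 m
  maybe′-cong f≗g (just x) = f≗g x
  maybe′-cong f≗g nothing  = refl

  maybe′-≡0 : ∀ {A : Set} {f : A → ℕ} → (∀ x → f x ≡ 0) → ∀ m → maybe′ f 0 m ≡ 0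
  maybe′-≡0 f≡0 (just x) = f≡0 x
  maybe′-≡0 f≡0 nothing  = refl

  *-maybe′ : ∀ {A : Set} c (f : A → ℕ) m → c * maybe′ f 0 m ≡ maybe′ (λ x → c * f x) 0 m
  *-maybe′ c f (just x) = refl
  *-maybe′ c f nothing  = *-zeroʳ c

  multinomialℕ-∷ : ∀ n k ks → multinomialℕ n (k ∷ ks) ≡ (n C k) * multinomialℕ (n ∸ k) ks
  multinomialℕ-∷ zero    k ks = refl
  multinomialℕ-∷ (suc n) k ks = refl

  multinomialℕ-0∷ : ∀ n ks → multinomialℕ n (0 ∷ ks) ≡ multinomialℕ n ks
  multinomialℕ-0∷ n ks = trans (multinomialℕ-∷ n 0 ks) (+-identityʳ _)

  multinomialℕ-zero : ∀ {r} (k : Vec ℕ r) → multinomialℕ 0 (toList k) ≡ 𝟙 (replicate r 0 ≟ᵛ k)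
  multinomialℕ-zero []          = refl
  multinomialℕ-zero (zero  ∷ k) = trans (+-identityʳ _) (multinomialℕ-zero k)
  multinomialℕ-zero (suc x ∷ k) = refl

  multinomialℕ-suc : ∀ {r} n (k : Vec ℕ r) →
    multinomialℕ (suc n) (toList k) ≡ ∑[ i < r ] maybe′ (multinomialℕ n ∘ toList) 0 (predAt i k)

  C*multinomialℕ-suc : ∀ {r} n y (ks : Vec ℕ r) →
    (n C suc y) * multinomialℕ (n ∸ y) (toList ks) ≡
    ∑[ i < r ] maybe′ (multinomialℕ n ∘ toList ∘ (suc y ∷_)) 0 (predAt i ks)

  multinomialℕ-suc n []           = refl
  multinomialℕ-suc {suc r} n (zero ∷ ks)  = begin
    multinomialℕ (suc n) (toList ks) + 0
      ≡⟨ +-identityʳ _ ⟩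
    multinomialℕ (suc n) (toList ks)
      ≡⟨ multinomialℕ-suc n ks ⟩
    ∑[ i < r ] maybe′ (multinomialℕ n ∘ toList) 0 (predAt i ks)
      ≡⟨ sum-cong-≗ (λ i → maybe′-cong (λ _ → sym (multinomialℕ-0∷ n _)) (predAt i ks)) ⟩
    ∑[ i < r ] maybe′ (multinomialℕ n ∘ toList ∘ (0 ∷_)) 0 (predAt i ks)
      ≡⟨ sum-cong-≗ (λ i → sym (maybe′-map _ (0 ∷_) (predAt i ks))) ⟩
    ∑[ i < r ] maybe′ (multinomialℕ n ∘ toList) 0 (Maybe.map (0 ∷_) (predAt i ks))
      ∎
    where open ≡-Reasoning
  multinomialℕ-suc {suc r} n (suc y ∷ ks) = begin
    (suc n C suc y) * rest
      ≡⟨ cong (_* rest) (nCk+nC[k+1]≡[n+1]C[k+1] n y) ⟨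
    (n C y + n C suc y) * rest
      ≡⟨ *-distribʳ-+ rest (n C y) (n C suc y) ⟩
    (n C y) * rest + (n C suc y) * rest
      ≡⟨ cong₂ _+_ (sym (multinomialℕ-∷ n y _)) (C*multinomialℕ-suc n y ks) ⟩
    multinomialℕ n (y ∷ toList ks) +
      ∑[ i < r ] maybe′ (multinomialℕ n ∘ toList ∘ (suc y ∷_)) 0 (predAt i ks)
      ≡⟨ cong (multinomialℕ n (y ∷ toList ks) +_)
              (sum-cong-≗ (λ i → sym (maybe′-map _ (suc y ∷_) (predAt i ks)))) ⟩
    multinomialℕ n (y ∷ toList ks) +
      ∑[ i < r ] maybe′ (multinomialℕ n ∘ toList) 0 (Maybe.map (suc y ∷_) (predAt i ks))
      ∎
    where
    open ≡-Reasoning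
    rest = multinomialℕ (n ∸ y) (toList ks)

  C*multinomialℕ-suc {r} n y ks = by-cases (y <? n)
    where
    open ≡-Reasoning
    c = n C suc y
    tail = λ k → multinomialℕ (n ∸ suc y) (toList k)
    lower : ∀ k → multinomialℕ n (suc y ∷ toList k) ≡ c * tail k
    lower k = multinomialℕ-∷ n (suc y) (toList k)
    by-cases : Dec (y < n) → c * multinomialℕ (n ∸ y) (toList ks) ≡
               ∑[ i < r ] maybe′ (multinomialℕ n ∘ toList ∘ (suc y ∷_)) 0 (predAt i ks)
    by-cases (yes y<n) = begin
      c * multinomialℕ (n ∸ y) (toList ks)
        ≡⟨ cong (λ m → c * multinomialℕ m (toList ks)) (+-∸-assoc 1 y<n) ⟩
      c * multinomialℕ (suc (n ∸ suc y)) (toList ks)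
        ≡⟨ cong (c *_) (multinomialℕ-suc (n ∸ suc y) ks) ⟩
      c * ∑[ i < r ] maybe′ tail 0 (predAt i ks)
        ≡⟨ *-distribˡ-sum c (λ i → maybe′ tail 0 (predAt i ks)) ⟩
      ∑[ i < r ] (c * maybe′ tail 0 (predAt i ks))
        ≡⟨ sum-cong-≗ (λ i → trans (*-maybe′ c tail (predAt i ks))
                                   (maybe′-cong (sym ∘ lower) (predAt i ks))) ⟩
      ∑[ i < r ] maybe′ (multinomialℕ n ∘ toList ∘ (suc y ∷_)) 0 (predAt i ks)
        ∎
    by-cases (no y≮n) = begin
      c * multinomialℕ (n ∸ y) (toList ks)
        ≡⟨ cong (_* multinomialℕ (n ∸ y) (toList ks)) c≡0 ⟩
      0
        ≡⟨ sum-replicate-zero r ⟨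
      ∑[ i < r ] 0
        ≡⟨ sum-cong-≗ (λ i → maybe′-≡0 (λ k → trans (lower k) (cong (_* tail k) c≡0)) (predAt i ks)) ⟨
      ∑[ i < r ] maybe′ (multinomialℕ n ∘ toList ∘ (suc y ∷_)) 0 (predAt i ks)
        ∎
      where
      c≡0 : c ≡ 0
      c≡0 = k>n⇒nCk≡0 (s≤s (≮⇒≥ y≮n))

  ∑ʷ-𝟙-updateAt : ∀ {r} n (i : Fin r) k →
    ∑ʷ n (λ u → 𝟙 (updateAt (tally u) i suc ≟ᵛ k)) ≡
    maybe′ (λ k′ → ∑ʷ n (λ u → 𝟙 (tally u ≟ᵛ k′))) 0 (predAt i k)
  ∑ʷ-𝟙-updateAt n i k with predAt i k in eq
  ... | nothing = trans
    (∑ʷ-cong n (λ u → 𝟙-no (updateAt (tally u) i suc ≟ᵛ k) (λ { refl → nothing≢just u eq })))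
    (∑ʷ-zero n)
    where
    nothing≢just : ∀ u → predAt i (updateAt (tally u) i suc) ≢ nothing
    nothing≢just u eq′ with () ← trans (sym eq′) (predAt-updateAt i (tally u))
  ... | just k′ = ∑ʷ-cong n (λ u → 𝟙-⇔ (updateAt (tally u) i suc ≟ᵛ k) (tally u ≟ᵛ k′)
    (λ { refl → just-injective (trans (sym (predAt-updateAt i (tally u))) eq) })
    (λ { refl → updateAt-predAt i k eq }))

  ∑ʷ-𝟙-tally : ∀ {r} n (k : Vec ℕ r) → ∑ʷ n (λ u → 𝟙 (tally u ≟ᵛ k)) ≡ multinomialℕ n (toList k)
  ∑ʷ-𝟙-tally         zero    k = sym (multinomialℕ-zero k)
  ∑ʷ-𝟙-tally {r = r} (suc n) k = begin
    ∑ʷ n (λ u → ∑[ i < r ] 𝟙 (updateAt (tally u) i suc ≟ᵛ k))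
      ≡⟨ ∑ʷ-∑-comm n (λ u i → 𝟙 (updateAt (tally u) i suc ≟ᵛ k)) ⟩
    ∑[ i < r ] ∑ʷ n (λ u → 𝟙 (updateAt (tally u) i suc ≟ᵛ k))
      ≡⟨ sum-cong-≗ (λ i → ∑ʷ-𝟙-updateAt n i k) ⟩
    ∑[ i < r ] maybe′ (λ k′ → ∑ʷ n (λ u → 𝟙 (tally u ≟ᵛ k′))) 0 (predAt i k)
      ≡⟨ sum-cong-≗ (λ i → maybe′-cong (∑ʷ-𝟙-tally n) (predAt i k)) ⟩
    ∑[ i < r ] maybe′ (multinomialℕ n ∘ toList) 0 (predAt i k)
      ≡⟨ multinomialℕ-suc n k ⟨
    multinomialℕ (suc n) (toList k)
      ∎
    where open ≡-Reasoning

  P : Fin 6 → Mat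
  P 0F = P₁
  P 1F = P₂
  P 2F = P₃
  P 3F = P₄
  P 4F = P₅
  P 5F = P₆

  wordSum : ∀ {n} → Word 6 n → Mat
  wordSum u = sumMats (toList (Vec.map P u))

  sum-map-concatMap : ∀ {A B : Set} (h : B → ℕ) (g : A → List B) xs →
    sum (List.map h (concatMap g xs)) ≡ sum (List.map (λ x → sum (List.map h (g x))) xs)
  sum-map-concatMap h g []       = refl
  sum-map-concatMap h g (x ∷ xs) = begin
    sum (List.map h (g x List.++ concatMap g xs))
      ≡⟨ cong sum (List.map-++ h (g x) (concatMap g xs)) ⟩
    sum (List.map h (g x) List.++ List.map h (concatMap g xs))
      ≡⟨ sum-++ (List.map h (g x)) _ ⟩
    sum (List.map h (g x)) + sum (List.map h (concatMap g xs))
      ≡⟨ cong (sum (List.map h (g x)) +_) (sum-map-concatMap h g xs) ⟩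
    sum (List.map h (g x)) + sum (List.map (λ y → sum (List.map h (g y))) xs)
      ∎
    where open ≡-Reasoning

  sum-words : ∀ n (h : List Mat → ℕ) → sum (List.map h (words n)) ≡ ∑ʷ n (λ u → h (toList (Vec.map P u)))
  sum-words zero    h = +-identityʳ (h [])
  sum-words (suc n) h = trans (sum-map-concatMap h _ (words n)) (sum-words n (λ w → ∑[ i < 6 ] h (P i ∷ w)))

  wordCount : ℕ → Mat → ℕ
  wordCount n A = ∑ʷ n (λ u → 𝟙 (wordSum u ≋? A))

  v≡wordCount : ∀ M → v M ≡ wordCount (ρ M) M
  v≡wordCount M = trans (length-filter (λ w → sumMats w ≋? M) (words (ρ M))) (sum-words (ρ M) _)

  ρ-≋ : ∀ {A B} → A ≋ B → ρ A ≡ ρ B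
  ρ-≋ A≋B = cong₂ _+_ (cong₂ _+_ (A≋B 0F 0F) (A≋B 0F 1F)) (A≋B 0F 2F)

  ρ-+M : ∀ A B → ρ (A +M B) ≡ ρ A + ρ B
  ρ-+M A B = trans (cong (_+ (a₃ + b₃)) (interchange a₁ b₁ a₂ b₂)) (interchange (a₁ + a₂) (b₁ + b₂) a₃ b₃)
    where
    a₁ = A 0F 0F
    a₂ = A 0F 1F
    a₃ = A 0F 2F
    b₁ = B 0F 0F
    b₂ = B 0F 1F
    b₃ = B 0F 2F

  ρ-P : ∀ i → ρ (P i) ≡ 1
  ρ-P 0F = refl
  ρ-P 1F = refl
  ρ-P 2F = refl
  ρ-P 3F = refl
  ρ-P 4F = refl
  ρ-P 5F = refl

  ρ-wordSum : ∀ {n} (u : Word 6 n) → ρ (wordSum u) ≡ n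
  ρ-wordSum []      = refl
  ρ-wordSum (i ∷ u) = trans (ρ-+M (P i) (wordSum u)) (cong₂ _+_ (ρ-P i) (ρ-wordSum u))

  wordCount-≢ : ∀ {n A} → ρ A ≢ n → wordCount n A ≡ 0
  wordCount-≢ {n} {A} ρA≢n = trans
    (∑ʷ-cong n (λ u → 𝟙-no (wordSum u ≋? A) (λ u≋A → ρA≢n (trans (sym (ρ-≋ u≋A)) (ρ-wordSum u)))))
    (∑ʷ-zero n)

  lincomb : ∀ {r} → (Fin r → Mat) → Vec ℕ r → Mat
  lincomb {r} Q c k l = ∑[ t < r ] (Q t k l * lookup c t)

  lincomb-updateAt : ∀ {r} (Q : Fin r → Mat) c i k l →
                     lincomb Q (updateAt c i suc) k l ≡ Q i k l + lincomb Q c k l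
  lincomb-updateAt Q (x ∷ c) zero    k l = trans (cong (_+ lincomb (Q ∘ suc) c k l) (*-suc (Q zero k l) x))
    (+-assoc (Q zero k l) (Q zero k l * x) (lincomb (Q ∘ suc) c k l))
  lincomb-updateAt Q (x ∷ c) (suc i) k l = trans
    (cong (Q zero k l * x +_) (lincomb-updateAt (Q ∘ suc) c i k l))
    (x∙yz≈y∙xz (Q zero k l * x) (Q (suc i) k l) (lincomb (Q ∘ suc) c k l))

  lincomb-zero : ∀ {r} (Q : Fin r → Mat) k l → lincomb Q (replicate r 0) k l ≡ 0
  lincomb-zero {zero}  Q k l = refl
  lincomb-zero {suc r} Q k l = cong₂ _+_ (*-zeroʳ (Q zero k l)) (lincomb-zero (Q ∘ suc) k l)

  sumMats-tally : ∀ {r n} (Q : Fin r → Mat) (u : Word r n) →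
                  sumMats (toList (Vec.map Q u)) ≋ lincomb Q (tally u)
  sumMats-tally Q []      k l = sym (lincomb-zero Q k l)
  sumMats-tally Q (i ∷ u) k l =
    trans (cong (Q i k l +_) (sumMats-tally Q u k l)) (sym (lincomb-updateAt Q (tally u) i k l))

  represents⇒lincomb : ∀ {a₁ a₂ a₃ a₄ a₅ a₆ M} → Represents a₁ a₂ a₃ a₄ a₅ a₆ M →
                       M ≋ lincomb P (a₁ ∷ a₂ ∷ a₃ ∷ a₄ ∷ a₅ ∷ a₆ ∷ [])
  represents⇒lincomb {a₁} {a₂} {a₃} {a₄} {a₅} {a₆} M≋ k l = trans (M≋ k l)
    (commute-scalars a₁ a₂ a₃ a₄ a₅ a₆ (P₁ k l) (P₂ k l) (P₃ k l) (P₄ k l) (P₅ k l) (P₆ k l))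
    where
    commute-scalars : ∀ a₁ a₂ a₃ a₄ a₅ a₆ p₁ p₂ p₃ p₄ p₅ p₆ →
      a₁ * p₁ + (a₂ * p₂ + (a₃ * p₃ + (a₄ * p₄ + (a₅ * p₅ + a₆ * p₆)))) ≡
      p₁ * a₁ + (p₂ * a₂ + (p₃ * a₃ + (p₄ * a₄ + (p₅ * a₅ + (p₆ * a₆ + 0)))))
    commute-scalars = solve-∀

  even odd : Fin 3 → Fin 6
  even = (Fin._↑ˡ 3)
  odd  = (3 Fin.↑ʳ_)

  pairSum : Vec ℕ 6 → Fin 3 → Fin 3 → ℕ
  pairSum c i j = lookup c (even i) + lookup c (odd j)

  -- Since 1 * x only computes to x + 0, an entry of lincomb P c normalises to the following.
  normalEntry : Vec ℕ 6 → Fin 3 → Fin 3 → ℕ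
  normalEntry c i j = lookup c (even i) + 0 + (lookup c (odd j) + 0 + 0)

  normalEntry≡pairSum : ∀ c i j → normalEntry c i j ≡ pairSum c i j
  normalEntry≡pairSum c i j = cong₂ _+_ (+-identityʳ x) (trans (+-identityʳ (y + 0)) (+-identityʳ y))
    where
    x = lookup c (even i)
    y = lookup c (odd j)

  entry≡pairSum : ∀ k l i j → (∀ c → lincomb P c k l ≡ normalEntry c i j) →
                  ∀ c → lincomb P c k l ≡ pairSum c i j
  entry≡pairSum k l i j normal c = trans (normal c) (normalEntry≡pairSum c i j)

  entry-pairSum : ∀ k l → ∃₂ λ i j → ∀ c → lincomb P c k l ≡ pairSum c i j
  entry-pairSum 0F 0F = _ , _ , entry≡pairSum 0F 0F 0F 2F λ _ → refl
  entry-pairSum 0F 1F = _ , _ , entry≡pairSum 0F 1F 2F 1F λ _ → refl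
  entry-pairSum 0F 2F = _ , _ , entry≡pairSum 0F 2F 1F 0F λ _ → refl
  entry-pairSum 1F 0F = _ , _ , entry≡pairSum 1F 0F 1F 1F λ _ → refl
  entry-pairSum 1F 1F = _ , _ , entry≡pairSum 1F 1F 0F 0F λ _ → refl
  entry-pairSum 1F 2F = _ , _ , entry≡pairSum 1F 2F 2F 2F λ _ → refl
  entry-pairSum 2F 0F = _ , _ , entry≡pairSum 2F 0F 2F 0F λ _ → refl
  entry-pairSum 2F 1F = _ , _ , entry≡pairSum 2F 1F 1F 2F λ _ → refl
  entry-pairSum 2F 2F = _ , _ , entry≡pairSum 2F 2F 0F 1F λ _ → refl

  pairSum-entry : ∀ i j → ∃₂ λ k l → ∀ c → lincomb P c k l ≡ pairSum c i j
  pairSum-entry 0F 0F = 1F , 1F , entry≡pairSum 1F 1F 0F 0F λ _ → refl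
  pairSum-entry 0F 1F = 2F , 2F , entry≡pairSum 2F 2F 0F 1F λ _ → refl
  pairSum-entry 0F 2F = 0F , 0F , entry≡pairSum 0F 0F 0F 2F λ _ → refl
  pairSum-entry 1F 0F = 0F , 2F , entry≡pairSum 0F 2F 1F 0F λ _ → refl
  pairSum-entry 1F 1F = 1F , 0F , entry≡pairSum 1F 0F 1F 1F λ _ → refl
  pairSum-entry 1F 2F = 2F , 1F , entry≡pairSum 2F 1F 1F 2F λ _ → refl
  pairSum-entry 2F 0F = 2F , 0F , entry≡pairSum 2F 0F 2F 0F λ _ → refl
  pairSum-entry 2F 1F = 0F , 1F , entry≡pairSum 0F 1F 2F 1F λ _ → refl
  pairSum-entry 2F 2F = 1F , 2F , entry≡pairSum 1F 2F 2F 2F λ _ → refl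

  pairSums-≡ : ∀ {c d} → lincomb P c ≋ lincomb P d → ∀ i j → pairSum c i j ≡ pairSum d i j
  pairSums-≡ {c} {d} c≋d i j with pairSum-entry i j
  ... | k , l , entry = trans (sym (entry c)) (trans (c≋d k l) (entry d))

  pairSums-shift : ∀ {I J : Set} {x a : I → ℕ} {y b : J → ℕ} (i₀ : I) {j₀ : J} →
    (∀ i j → x i + y j ≡ a i + b j) → b j₀ ≡ 0 → (∀ i → x i + y j₀ ≡ a i) × (∀ j → y j ≡ b j + y j₀)
  pairSums-shift {x = x} {a} {y} {b} i₀ {j₀} sums b₀≡0 = x+t≡a , y≡b+t
    where
    x+t≡a : ∀ i → x i + y j₀ ≡ a i
    x+t≡a i = trans (sums i j₀) (trans (cong (a i +_) b₀≡0) (+-identityʳ (a i)))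
    y≡b+t : ∀ j → y j ≡ b j + y j₀
    y≡b+t j = +-cancelˡ-≡ (x i₀) (y j) (b j + y j₀) (begin
      x i₀ + y j          ≡⟨ sums i₀ j ⟩
      a i₀ + b j          ≡⟨ cong (_+ b j) (x+t≡a i₀) ⟨
      x i₀ + y j₀ + b j   ≡⟨ +-assoc (x i₀) (y j₀) (b j) ⟩
      x i₀ + (y j₀ + b j) ≡⟨ cong (x i₀ +_) (+-comm (y j₀) (b j)) ⟩
      x i₀ + (b j + y j₀) ∎)
      where open ≡-Reasoning

  lookup-ext : ∀ {A : Set} {n} {u v : Vec A n} → (∀ i → lookup u i ≡ lookup v i) → u ≡ v
  lookup-ext {u = u} {v} u≗v =
    trans (sym (Vec.tabulate∘lookup u)) (trans (Vec.tabulate-cong u≗v) (Vec.tabulate∘lookup v))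

  lookup-even : ∀ (x y : Vec ℕ 3) i → lookup (x Vec.++ y) (even i) ≡ lookup x i
  lookup-even x y i = Vec.lookup-++ˡ x y i

  lookup-odd : ∀ (x y : Vec ℕ 3) j → lookup (x Vec.++ y) (odd j) ≡ lookup y j
  lookup-odd x y j = Vec.lookup-++ʳ x y j

  shifted : Vec ℕ 3 → Vec ℕ 3 → ℕ → Vec ℕ 6
  shifted a b t = Vec.map (_∸ t) a Vec.++ Vec.map (_+ t) b

  IsShift : Vec ℕ 3 → Vec ℕ 3 → ℕ → Vec ℕ 6 → Set
  IsShift a b t c = All (t ≤_) a × c ≡ shifted a b t

  isShift? : ∀ a b t c → Dec (IsShift a b t c)
  isShift? a b t c = All.all? (t ≤?_) a ×-dec (c ≟ᵛ shifted a b t)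

  isShift-unique : ∀ {a b s t c} → IsShift a b s c → IsShift a b t c → s ≡ t
  isShift-unique {a} {b} {s} {t} (_ , refl) (_ , c≡t) = +-cancelˡ-≡ (lookup b 0F) s t (begin
    lookup b 0F + s                    ≡⟨ Vec.lookup-map 0F (_+ s) b ⟨
    lookup (Vec.map (_+ s) b) 0F       ≡⟨ lookup-odd (Vec.map (_∸ s) a) _ 0F ⟨
    lookup (shifted a b s) (odd 0F)    ≡⟨ cong (λ c → lookup c (odd 0F)) c≡t ⟩
    lookup (shifted a b t) (odd 0F)    ≡⟨ lookup-odd (Vec.map (_∸ t) a) _ 0F ⟩
    lookup (Vec.map (_+ t) b) 0F       ≡⟨ Vec.lookup-map 0F (_+ t) b ⟩
    lookup b 0F + t                    ∎)
    where open ≡-Reasoning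

  isShift⇒≋ : ∀ {a b t c} → IsShift a b t c → lincomb P c ≋ lincomb P (a Vec.++ b)
  isShift⇒≋ {a} {b} {t} (t≤a , refl) k l with entry-pairSum k l
  ... | i , j , entry = begin
    lincomb P (shifted a b t) k l
      ≡⟨ entry (shifted a b t) ⟩
    pairSum (shifted a b t) i j
      ≡⟨ cong₂ _+_ (lookup-even (Vec.map (_∸ t) a) _ i) (lookup-odd (Vec.map (_∸ t) a) _ j) ⟩
    lookup (Vec.map (_∸ t) a) i + lookup (Vec.map (_+ t) b) j
      ≡⟨ cong₂ _+_ (Vec.lookup-map i (_∸ t) a) (Vec.lookup-map j (_+ t) b) ⟩
    (lookup a i ∸ t) + (lookup b j + t)
      ≡⟨ ∸-+-shift (lookup⁺ t≤a i) ⟩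
    lookup a i + lookup b j
      ≡⟨ cong₂ _+_ (lookup-even a b i) (lookup-odd a b j) ⟨
    pairSum (a Vec.++ b) i j
      ≡⟨ entry (a Vec.++ b) ⟨
    lincomb P (a Vec.++ b) k l
      ∎
    where
    open ≡-Reasoning
    ∸-+-shift : ∀ {x y t} → t ≤ x → (x ∸ t) + (y + t) ≡ x + y
    ∸-+-shift {x} {y} {t} t≤x = begin
      (x ∸ t) + (y + t) ≡⟨ cong ((x ∸ t) +_) (+-comm y t) ⟩
      (x ∸ t) + (t + y) ≡⟨ +-assoc (x ∸ t) t y ⟨
      (x ∸ t) + t + y   ≡⟨ cong (_+ y) (m∸n+n≡m t≤x) ⟩
      x + y             ∎

  ≋⇒isShift : ∀ {a b} c → lincomb P c ≋ lincomb P (a Vec.++ b) → ∀ {j₀} → lookup b j₀ ≡ 0 →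
              ∃ λ t → IsShift a b t c
  ≋⇒isShift {a} {b} c c≋ab {j₀} b₀≡0 with Vec.splitAt 3 c
  ... | x , y , refl = t , lookup⁻ t≤a , cong₂ Vec._++_ x≡a∸t y≡b+t
    where
    sums : ∀ i j → lookup x i + lookup y j ≡ lookup a i + lookup b j
    sums i j = begin
      lookup x i + lookup y j   ≡⟨ cong₂ _+_ (lookup-even x y i) (lookup-odd x y j) ⟨
      pairSum (x Vec.++ y) i j  ≡⟨ pairSums-≡ {x Vec.++ y} {a Vec.++ b} c≋ab i j ⟩
      pairSum (a Vec.++ b) i j  ≡⟨ cong₂ _+_ (lookup-even a b i) (lookup-odd a b j) ⟩
      lookup a i + lookup b j   ∎
      where open ≡-Reasoning
    shift = pairSums-shift 0F sums b₀≡0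
    t = lookup y j₀
    t≤a : ∀ i → t ≤ lookup a i
    t≤a i = subst (t ≤_) (proj₁ shift i) (m≤n+m t (lookup x i))
    x≡a∸t : x ≡ Vec.map (_∸ t) a
    x≡a∸t = lookup-ext λ i → trans (sym (m+n∸n≡m (lookup x i) t))
      (trans (cong (_∸ t) (proj₁ shift i)) (sym (Vec.lookup-map i (_∸ t) a)))
    y≡b+t : y ≡ Vec.map (_+ t) b
    y≡b+t = lookup-ext λ j → trans (proj₂ shift j) (sym (Vec.lookup-map j (_+ t) b))

  ≤-minEntry : ∀ {t} A → (∀ k l → t ≤ A k l) → t ≤ minEntry A
  ≤-minEntry A t≤A = ⊓-glb (⊓-glb (row 0F) (row 1F)) (row 2F)
    where row = λ k → ⊓-glb (⊓-glb (t≤A k 0F) (t≤A k 1F)) (t≤A k 2F)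

  isShift-bound : ∀ {M a b t c} → M ≋ lincomb P (a Vec.++ b) → IsShift a b t c → t ≤ minEntry M
  isShift-bound {M} {a} {b} {t} M≋ab (t≤a , _) = ≤-minEntry M t≤M
    where
    t≤M : ∀ k l → t ≤ M k l
    t≤M k l with entry-pairSum k l
    ... | i , j , entry =
      ≤-trans (lookup⁺ t≤a i) (subst (lookup a i ≤_) a+b≡M (m≤m+n (lookup a i) (lookup b j)))
      where
      a+b≡M : lookup a i + lookup b j ≡ M k l
      a+b≡M = trans (sym (cong₂ _+_ (lookup-even a b i) (lookup-odd a b j)))
                    (trans (sym (entry (a Vec.++ b))) (sym (M≋ab k l)))

  [+m]-[+n]≡+[m∸n] : ∀ {m n} → n ≤ m → ℤ.+ m ℤ.- ℤ.+ n ≡ ℤ.+ (m ∸ n)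
  [+m]-[+n]≡+[m∸n] {m} {n} n≤m = trans (ℤ.[+m]-[+n]≡m⊖n m n) (ℤ.⊖-≥ n≤m)

  [+m]-[+n]≡-[1+n∸1+m] : ∀ {m n} → m < n → ℤ.+ m ℤ.- ℤ.+ n ≡ -[1+ (n ∸ suc m) ]
  [+m]-[+n]≡-[1+n∸1+m] {m} {n} m<n =
    trans (ℤ.[+m]-[+n]≡m⊖n m n) (trans (ℤ.⊖-< m<n) (cong (λ k → ℤ.- ℤ.+ k) (+-∸-assoc 1 m<n)))

  shiftedIndices : Vec ℕ 3 → Vec ℕ 3 → ℕ → List ℤ
  shiftedIndices (a₁ ∷ a₂ ∷ a₃ ∷ []) (a₄ ∷ a₅ ∷ a₆ ∷ []) t =
    ℤ.+ a₁ ℤ.- ℤ.+ t ∷ ℤ.+ a₂ ℤ.- ℤ.+ t ∷ ℤ.+ a₃ ℤ.- ℤ.+ t ∷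
    ℤ.+ a₄ ℤ.+ ℤ.+ t ∷ ℤ.+ a₅ ℤ.+ ℤ.+ t ∷ ℤ.+ a₆ ℤ.+ ℤ.+ t ∷ []

  multinomial-shiftedIndices-≤ : ∀ n a b {t} → All (t ≤_) a →
    multinomial n (shiftedIndices a b t) ≡ multinomialℕ n (toList (shifted a b t))
  multinomial-shiftedIndices-≤ n (a₁ ∷ a₂ ∷ a₃ ∷ []) (a₄ ∷ a₅ ∷ a₆ ∷ []) (t≤a₁ ∷ t≤a₂ ∷ t≤a₃ ∷ [])
    rewrite [+m]-[+n]≡+[m∸n] t≤a₁ | [+m]-[+n]≡+[m∸n] t≤a₂ | [+m]-[+n]≡+[m∸n] t≤a₃ = refl

  multinomial-shiftedIndices-≰ : ∀ n a b {t} → ¬ All (t ≤_) a → multinomial n (shiftedIndices a b t) ≡ 0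
  multinomial-shiftedIndices-≰ n (a₁ ∷ a₂ ∷ a₃ ∷ []) (a₄ ∷ a₅ ∷ a₆ ∷ []) {t} t≰a
    with t ≤? a₁ | t ≤? a₂ | t ≤? a₃
  ... | no t≰a₁  | _        | _
      rewrite [+m]-[+n]≡-[1+n∸1+m] (≰⇒> t≰a₁) = refl
  ... | yes t≤a₁ | no t≰a₂  | _
      rewrite [+m]-[+n]≡+[m∸n] t≤a₁ | [+m]-[+n]≡-[1+n∸1+m] (≰⇒> t≰a₂) = refl
  ... | yes t≤a₁ | yes t≤a₂ | no t≰a₃
      rewrite [+m]-[+n]≡+[m∸n] t≤a₁ | [+m]-[+n]≡+[m∸n] t≤a₂ | [+m]-[+n]≡-[1+n∸1+m] (≰⇒> t≰a₃) = refl
  ... | yes t≤a₁ | yes t≤a₂ | yes t≤a₃ = ⊥-elim (t≰a (t≤a₁ ∷ t≤a₂ ∷ t≤a₃ ∷ []))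

  ∑ʷ-𝟙-isShift : ∀ n a b t →
                 ∑ʷ n (λ u → 𝟙 (isShift? a b t (tally u))) ≡ multinomial n (shiftedIndices a b t)
  ∑ʷ-𝟙-isShift n a b t = count (All.all? (t ≤?_) a)
    where
    open ≡-Reasoning
    count : Dec (All (t ≤_) a) →
            ∑ʷ n (λ u → 𝟙 (isShift? a b t (tally u))) ≡ multinomial n (shiftedIndices a b t)
    count (yes t≤a) = begin
      ∑ʷ n (λ u → 𝟙 (isShift? a b t (tally u)))
        ≡⟨ ∑ʷ-cong n (λ u → 𝟙-⇔ (isShift? a b t (tally u)) (tally u ≟ᵛ shifted a b t) proj₂ (t≤a ,_)) ⟩
      ∑ʷ n (λ u → 𝟙 (tally u ≟ᵛ shifted a b t))
        ≡⟨ ∑ʷ-𝟙-tally n (shifted a b t) ⟩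
      multinomialℕ n (toList (shifted a b t))
        ≡⟨ multinomial-shiftedIndices-≤ n a b t≤a ⟨
      multinomial n (shiftedIndices a b t)
        ∎
    count (no t≰a) = begin
      ∑ʷ n (λ u → 𝟙 (isShift? a b t (tally u)))
        ≡⟨ ∑ʷ-cong n (λ u → 𝟙-no (isShift? a b t (tally u)) (t≰a ∘ proj₁)) ⟩
      ∑ʷ n (λ _ → 0)
        ≡⟨ ∑ʷ-zero n ⟩
      0
        ≡⟨ multinomial-shiftedIndices-≰ n a b t≰a ⟨
      multinomial n (shiftedIndices a b t)
        ∎

  upshifted-zero : ∀ {a₄ a₅ a₆} → a₄ ≡ 0 ⊎ a₅ ≡ 0 ⊎ a₆ ≡ 0 → ∃ λ j → lookup (a₄ ∷ a₅ ∷ a₆ ∷ []) j ≡ 0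
  upshifted-zero (inj₁ a₄≡0)        = 0F , a₄≡0
  upshifted-zero (inj₂ (inj₁ a₅≡0)) = 1F , a₅≡0
  upshifted-zero (inj₂ (inj₂ a₆≡0)) = 2F , a₆≡0

  v-upshifted : ∀ M a b → M ≋ lincomb P (a Vec.++ b) → (∃ λ j → lookup b j ≡ 0) →
                v M ≡ sumTo (minEntry M) (λ t → multinomial (ρ M) (shiftedIndices a b t))
  v-upshifted M a b M≋ab (_ , b₀≡0) = begin
    v M
      ≡⟨ v≡wordCount M ⟩
    ∑ʷ n (λ u → 𝟙 (wordSum u ≋? M))
      ≡⟨ ∑ʷ-cong n (λ u → sym (shifts u)) ⟩
    ∑ʷ n (λ u → sumTo m (λ t → 𝟙 (isShift? a b t (tally u))))
      ≡⟨ ∑ʷ-sum-comm n _ (upTo (suc m)) ⟩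
    sumTo m (λ t → ∑ʷ n (λ u → 𝟙 (isShift? a b t (tally u))))
      ≡⟨ cong sum (List.map-cong (∑ʷ-𝟙-isShift n a b) (upTo (suc m))) ⟩
    sumTo m (λ t → multinomial n (shiftedIndices a b t))
      ∎
    where
    open ≡-Reasoning
    n = ρ M
    m = minEntry M
    shifts : ∀ u → sumTo m (λ t → 𝟙 (isShift? a b t (tally u))) ≡ 𝟙 (wordSum u ≋? M)
    shifts u = sumTo-𝟙-unique m (λ t → isShift? a b t (tally u)) isShift-unique (isShift-bound M≋ab)
                               (map′ to from (wordSum u ≋? M))
      where
      to : wordSum u ≋ M → ∃ λ t → IsShift a b t (tally u)
      to u≋M = ≋⇒isShift (tally u)
        (λ k l → trans (sym (sumMats-tally P u k l)) (trans (u≋M k l) (M≋ab k l))) b₀≡0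
      from : (∃ λ t → IsShift a b t (tally u)) → wordSum u ≋ M
      from (_ , shift) k l = trans (sumMats-tally P u k l) (trans (isShift⇒≋ shift k l) (sym (M≋ab k l)))

  Reindexing : Set
  Reindexing = Fin 3 → Fin 3 → Fin 3 × Fin 3

  infixr 25 _⊙_
  _⊙_ : Reindexing → Mat → Mat
  (p ⊙ A) k l = uncurry A (p k l)

  rows cols : (Fin 3 → Fin 3) → Reindexing
  rows f k l = f k , l
  cols f k l = k , f l

  transposition : Reindexing
  transposition k l = l , k

  Permutes : Reindexing → Set
  Permutes p = (∀ i → ∃ λ j → p ⊙ P i ≋ P j) × (∀ j → ∃ λ i → p ⊙ P i ≋ P j)

  permutes? : ∀ p → Dec (Permutes p)
  permutes? p = all? (λ i → any? λ j → p ⊙ P i ≋? P j) ×-dec all? (λ j → any? λ i → p ⊙ P i ≋? P j)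

  Permutes-≗ : ∀ {p q} → (∀ k l → p k l ≡ q k l) → Permutes p → Permutes q
  Permutes-≗ {p} {q} p≗q (images , preimages) =
    (λ i → proj₁ (images i) , λ k l → trans (sym (p⊙≗q⊙ (P i) k l)) (proj₂ (images i) k l)) ,
    (λ j → proj₁ (preimages j) ,
           λ k l → trans (sym (p⊙≗q⊙ (P (proj₁ (preimages j))) k l)) (proj₂ (preimages j) k l))
    where
    p⊙≗q⊙ : ∀ A → p ⊙ A ≋ q ⊙ A
    p⊙≗q⊙ A k l = cong (uncurry A) (p≗q k l)

  Distinct : Fin 3 → Fin 3 → Fin 3 → Set
  Distinct x y z = x ≢ y × x ≢ z × y ≢ z

  distinct? : ∀ x y z → Dec (Distinct x y z)
  distinct? x y z = ¬? (x Fin.≟ y) ×-dec ¬? (x Fin.≟ z) ×-dec ¬? (y Fin.≟ z)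

  P-injective : ∀ {i j} → P i ≋ P j → i ≡ j
  P-injective {i} {j} = toWitness {a? = all? λ i → all? λ j → (P i ≋? P j) →-dec (i Fin.≟ j)} _ i j

  rows-permute : ∀ x y z → Distinct x y z → Permutes (rows (lookup (x ∷ y ∷ z ∷ [])))
  rows-permute = toWitness {a? = all? λ x → all? λ y → all? λ z →
    distinct? x y z →-dec permutes? (rows (lookup (x ∷ y ∷ z ∷ [])))} _

  cols-permute : ∀ x y z → Distinct x y z → Permutes (cols (lookup (x ∷ y ∷ z ∷ [])))
  cols-permute = toWitness {a? = all? λ x → all? λ y → all? λ z →
    distinct? x y z →-dec permutes? (cols (lookup (x ∷ y ∷ z ∷ [])))} _

  transposition-permutes : Permutes transposition
  transposition-permutes = toWitness {a? = permutes? transposition} _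

  permutation-distinct : (σ : Permutation′ 3) → Distinct (σ ⟨$⟩ʳ 0F) (σ ⟨$⟩ʳ 1F) (σ ⟨$⟩ʳ 2F)
  permutation-distinct σ = (λ e → 0≢1 (injective e)) , (λ e → 0≢2 (injective e)) , (λ e → 1≢2 (injective e))
    where
    injective : ∀ {i j} → σ ⟨$⟩ʳ i ≡ σ ⟨$⟩ʳ j → i ≡ j
    injective {i} {j} e = trans (sym (inverseˡ σ)) (trans (cong (σ ⟨$⟩ˡ_) e) (inverseˡ σ))
    0≢1 : 0F ≢ 1F
    0≢1 ()
    0≢2 : 0F ≢ 2F
    0≢2 ()
    1≢2 : 1F ≢ 2F
    1≢2 ()

  record IsSymmetry (p : Reindexing) : Set where
    field
      onto     : ∀ k l → ∃₂ λ k′ l′ → p k′ l′ ≡ (k , l)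
      permutes : Permutes p

  rows-symmetry : (σ : Permutation′ 3) → IsSymmetry (rows (σ ⟨$⟩ʳ_))
  rows-symmetry σ = record
    { onto     = λ k l → σ ⟨$⟩ˡ k , l , cong (_, l) (inverseʳ σ)
    ; permutes = Permutes-≗ (λ k l → cong (_, l) (Vec.lookup∘tabulate (σ ⟨$⟩ʳ_) k))
                            (rows-permute _ _ _ (permutation-distinct σ))
    }

  cols-symmetry : (σ : Permutation′ 3) → IsSymmetry (cols (σ ⟨$⟩ʳ_))
  cols-symmetry σ = record
    { onto     = λ k l → k , σ ⟨$⟩ˡ l , cong (k ,_) (inverseʳ σ)
    ; permutes = Permutes-≗ (λ k l → cong (k ,_) (Vec.lookup∘tabulate (σ ⟨$⟩ʳ_) l))
                            (cols-permute _ _ _ (permutation-distinct σ))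
    }

  transposition-symmetry : IsSymmetry transposition
  transposition-symmetry = record
    { onto     = λ k l → l , k , refl
    ; permutes = transposition-permutes
    }

  module _ {p : Reindexing} (S : IsSymmetry p) where
    open IsSymmetry S

    ⊙-injective : ∀ {A B} → p ⊙ A ≋ p ⊙ B → A ≋ B
    ⊙-injective {A} {B} pA≋pB k l with onto k l
    ... | k′ , l′ , p≡kl =
      trans (cong (uncurry A) (sym p≡kl)) (trans (pA≋pB k′ l′) (cong (uncurry B) p≡kl))

    letters : Permutation′ 6
    letters = permutation image preimage image∘preimage preimage∘image
      where
      image = proj₁ ∘ proj₁ permutes
      preimage = proj₁ ∘ proj₂ permutes
      image∘preimage : ∀ j → image (preimage j) ≡ j
      image∘preimage j = P-injective λ k l →
        trans (sym (proj₂ (proj₁ permutes (preimage j)) k l)) (proj₂ (proj₂ permutes j) k l)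
      preimage∘image : ∀ i → preimage (image i) ≡ i
      preimage∘image i = P-injective (⊙-injective λ k l →
        trans (proj₂ (proj₂ permutes (image i)) k l) (sym (proj₂ (proj₁ permutes i) k l)))

    ⊙-wordSum : ∀ {n} (u : Word 6 n) → p ⊙ wordSum u ≋ wordSum (Vec.map (letters ⟨$⟩ʳ_) u)
    ⊙-wordSum []      k l = refl
    ⊙-wordSum (i ∷ u) k l = cong₂ _+_ (proj₂ (proj₁ permutes i) k l) (⊙-wordSum u k l)

    wordCount-⊙ : ∀ n A → wordCount n (p ⊙ A) ≡ wordCount n A
    wordCount-⊙ n A = trans (∑ʷ-permute n letters _) (∑ʷ-cong n λ u →
      𝟙-⇔ (wordSum (Vec.map (letters ⟨$⟩ʳ_) u) ≋? p ⊙ A) (wordSum u ≋? A)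
        (λ πu≋pA → ⊙-injective λ k l → trans (⊙-wordSum u k l) (πu≋pA k l))
        (λ u≋A k l → trans (sym (⊙-wordSum u k l)) (uncurry u≋A (p k l))))

    -- A word of length n sums to a square of line sum n, so if p changes the line sum both counts vanish.
    v-⊙ : ∀ A → v (p ⊙ A) ≡ v A
    v-⊙ A = by-line-sums (ρ (p ⊙ A) ≟ ρ A)
      where
      open ≡-Reasoning
      by-line-sums : Dec (ρ (p ⊙ A) ≡ ρ A) → v (p ⊙ A) ≡ v A
      by-line-sums (yes ρ≡) = begin
        v (p ⊙ A)                     ≡⟨ v≡wordCount (p ⊙ A) ⟩
        wordCount (ρ (p ⊙ A)) (p ⊙ A) ≡⟨ wordCount-⊙ (ρ (p ⊙ A)) A ⟩
        wordCount (ρ (p ⊙ A)) A       ≡⟨ cong (λ n → wordCount n A) ρ≡ ⟩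
        wordCount (ρ A) A             ≡⟨ v≡wordCount A ⟨
        v A                           ∎
      by-line-sums (no ρ≢) = begin
        v (p ⊙ A)                     ≡⟨ v≡wordCount (p ⊙ A) ⟩
        wordCount (ρ (p ⊙ A)) (p ⊙ A) ≡⟨ wordCount-⊙ (ρ (p ⊙ A)) A ⟩
        wordCount (ρ (p ⊙ A)) A       ≡⟨ wordCount-≢ {A = A} (ρ≢ ∘ sym) ⟩
        0                             ≡⟨ wordCount-≢ {A = p ⊙ A} ρ≢ ⟨
        wordCount (ρ A) (p ⊙ A)       ≡⟨ wordCount-⊙ (ρ A) A ⟩
        wordCount (ρ A) A             ≡⟨ v≡wordCount A ⟨
        v A                           ∎

  v-act : ∀ g M → v (act g M) ≡ v M
  v-act idG            M = refl
  v-act (rowP σ g)     M = trans (v-⊙ (rows-symmetry σ) (act g M)) (v-act g M)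
  v-act (colP σ g)     M = trans (v-⊙ (cols-symmetry σ) (act g M)) (v-act g M)
  v-act (Defs.trans g) M = trans (v-⊙ transposition-symmetry (act g M)) (v-act g M)

open SemiMagicPaths using (v-upshifted; represents⇒lincomb; upshifted-zero; v-act)
open import Defs
open import Data.Nat using (ℕ)
open import Data.Integer using (ℤ; +_; _-_; _+_)
open import Data.List using (_∷_; [])
open import Data.Product using (_×_; _,_)
open import Relation.Binary.PropositionalEquality using (_≡_)
import Data.Vec as Vec

theorem5p1 : ((M : Mat) → SemiMagic M → (a₁ a₂ a₃ a₄ a₅ a₆ : ℕ) → Upshifted a₁ a₂ a₃ a₄ a₅ a₆ M →
                v M ≡ sumTo (minEntry M) (λ t → multinomial (ρ M)
                        ((+ a₁ - + t) ∷ (+ a₂ - + t) ∷ (+ a₃ - + t) ∷ (+ a₄ + + t) ∷ (+ a₅ + + t) ∷ (+ a₆ + + t) ∷ [])))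
             × ((M : Mat) → SemiMagic M → (g : GWord) → v (act g M) ≡ v M)
theorem5p1 =
  (λ M _ a₁ a₂ a₃ a₄ a₅ a₆ (represents , upshifted) →
     v-upshifted M (a₁ Vec.∷ a₂ Vec.∷ a₃ Vec.∷ Vec.[]) (a₄ Vec.∷ a₅ Vec.∷ a₆ Vec.∷ Vec.[])
       (represents⇒lincomb represents) (upshifted-zero upshifted)) ,
  (λ M _ g → v-act g M)
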